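{- For every $n\ge 3$, $$D_t(T_n,x)=(x+1)D_t(G_{n-1},x)+x^2\big[D_t(G_{n-2},x)+D_t(G_{n-3},x)\big].$$
   Context: All graphs are finite and simple. A set $D$ of vertices of a graph $G$ is a total dominating set if every vertex of $G$ is adjacent to some vertex of $D$; $d_t(G,i)$ is the number of total dominating sets of size $i$, and $D_t(G,x)=\sum_{i\ge1}d_t(G,i)x^i$. The chain triangular cactus $T_n$ ($n\ge1$) consists of triangles $t_1,\dots,t_n$ such that $t_i$ and $t_{i+1}$ share exactly one vertex, non-consecutive triangles are vertex-disjoint, and for $2\le i\le n-1$ the vertex shared by $t_i$ with $t_{i-1}$ differs from the vertex shared by $t_i$ with $t_{i+1}$ (all such graphs of length $n$ are isomorphic); $T_0$ is a single vertex. For $n\ge1$, $G_n$ is obtained from $T_n$ by adding a new vertex joined by an edge to a vertex of the end triangle $t_n$ that is not shared with $t_{n-1}$ (any vertex of $t_1$ when $n=1$); $G_0=K_2$. -}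

module Defs where

open import Data.Bool using (Bool; true; false; _∧_; _∨_; not; if_then_else_)
open import Data.Nat using (ℕ; zero; suc; _+_; _*_; _∸_; _≡ᵇ_; _<ᵇ_; _≤ᵇ_)
open import Data.Fin using (Fin; toℕ)
open import Data.Vec using (Vec; []; _∷_)
open import Data.List using (List; []; _∷_; _++_; map; filter; length)
open import Data.Bool.ListAction using (all; any)
open import Data.List using () renaming (allFin to allFinL)
open import Data.Product using (Σ; _,_; proj₁)
open import Data.Bool.Properties using (T?)

-- Finite simple graphs: a vertex count m (vertices Fin m) and a Boolean
-- adjacency relation (our concrete graphs are symmetric and irreflexive).

record Graph : Set where
  constructor mkGraph
  field
    size : ℕ
    adj  : Fin size → Fin size → Bool
open Graph public

Subset : ℕ → Set
Subset m = Vec Bool m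

allSubsets : (m : ℕ) → List (Subset m)
allSubsets zero    = [] ∷ []
allSubsets (suc m) = map (true ∷_) (allSubsets m) ++ map (false ∷_) (allSubsets m)

member : ∀ {m} → Subset m → Fin m → Bool
member (b ∷ _) Fin.zero    = b
member (_ ∷ s) (Fin.suc k) = member s k

card : ∀ {m} → Subset m → ℕ
card []          = 0
card (true ∷ s)  = suc (card s)
card (false ∷ s) = card s

isTotalDominating : (G : Graph) → Subset (size G) → Bool
isTotalDominating G D =
  all (λ v → any (λ u → member D u ∧ adj G u v) (allFinL (size G))) (allFinL (size G))

dt : Graph → ℕ → ℕ
dt G i = length (filter (λ D → T? (isTotalDominating G D ∧ (card D ≡ᵇ i))) (allSubsets (size G)))

Poly : Set
Poly = ℕ → ℕ

_⊕_ : Poly → Poly → Poly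
(p ⊕ q) i = p i + q i
infixl 6 _⊕_

X· : Poly → Poly
X· p zero    = 0
X· p (suc i) = p i

Dt : Graph → Poly
Dt G zero    = 0
Dt G (suc i) = dt G (suc i)

-- Chain triangular cactus T_n on vertices 0..2n.
-- Triangle t_i (1 ≤ i ≤ n) is {2i-2, 2i-1, 2i}; t_i and t_{i+1} share 2i.
-- Edges {u,v}, u < v:  v = u+1 (v ≤ 2n), or u even and v = u+2 (v ≤ 2n).

evenᵇ : ℕ → Bool
evenᵇ zero          = true
evenᵇ (suc zero)    = false
evenᵇ (suc (suc k)) = evenᵇ k

edgeLt : ℕ → ℕ → ℕ → Bool
edgeLt n u v = (v ≤ᵇ (2 * n)) ∧ ((v ≡ᵇ suc u) ∨ (evenᵇ u ∧ (v ≡ᵇ suc (suc u))))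

tAdj : ℕ → ℕ → ℕ → Bool
tAdj n u v = ((u <ᵇ v) ∧ edgeLt n u v) ∨ ((v <ᵇ u) ∧ edgeLt n v u)

T : ℕ → Graph
T n = mkGraph (suc (2 * n)) (λ u v → tAdj n (toℕ u) (toℕ v))

-- G_n (n ≥ 1): T_n plus vertex 2n+1 joined to vertex 2n-1 (a vertex of t_n
-- not shared with t_{n-1}); G_0 = K_2.
pendAdj : ℕ → ℕ → ℕ → Bool
pendAdj n u v = ((u ≡ᵇ suc (2 * n)) ∧ (v ≡ᵇ (2 * n ∸ 1)))
              ∨ ((v ≡ᵇ suc (2 * n)) ∧ (u ≡ᵇ (2 * n ∸ 1)))

G : ℕ → Graph
G zero    = mkGraph 2 (λ u v → not (toℕ u ≡ᵇ toℕ v))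
G (suc k) = mkGraph (suc (suc (2 * suc k)))
  (λ u v → tAdj (suc k) (toℕ u) (toℕ v) ∨ pendAdj (suc k) (toℕ u) (toℕ v))

-- Transfer-matrix argument. Read along the chain, total domination of the cactus is a condition
-- on windows of five consecutive vertices. So the size-generating polynomials of the dominating
-- completions of a chain tail, indexed by the bits (a, b, c) of its first triangle, arise from
-- those of a tail one triangle shorter by a fixed linear operator (prepending a triangle), whether
-- the tail ends as in T_n or as in G_n. Being linear, this operator preserves the recurrence, so
-- the recurrence between the tails of T and of G, checked by computation for one length, holds
-- for all lengths; a second linear map (choosing the first triangle) carries it to D_t(T_n) and
-- D_t(G_n). The cases n = 3, 4 are computed directly.

module Submission where

open import Defs
open import Algebra.Properties.CommutativeSemigroup using (interchange)
open import Data.Bool using (Bool; true; false; _∧_; _∨_; not) renaming (T to IsTrue)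
open import Data.Bool.ListAction using (all; any)
open import Data.Bool.Properties using (T?; T-∧; T-∨; ∧-zeroʳ)
open import Data.Empty using (⊥-elim)
open import Data.Fin using (Fin; toℕ; fromℕ<)
open import Data.Fin.Properties using (toℕ-fromℕ<; toℕ<n)
open import Data.List using (List; []; _∷_; _++_; map; filter; length) renaming (allFin to allFinL)
open import Data.List.Membership.Propositional using (lose)
open import Data.List.Membership.Propositional.Properties using (∈-allFin)
open import Data.List.Properties using (length-++; filter-++)
import Data.List.Relation.Unary.All as All
open import Data.List.Relation.Unary.All.Properties using (all⁺; all⁻)
open import Data.List.Relation.Unary.Any using (satisfied)
open import Data.List.Relation.Unary.Any.Properties using (any⁺; any⁻)
open import Data.Nat using (ℕ; zero; suc; _+_; _*_; _∸_; _≤_; _<_; z≤n; s≤s; _≡ᵇ_; _<ᵇ_)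
open import Data.Nat.Properties
  using ( +-commutativeSemigroup; +-comm; +-suc; +-identityʳ; ≡⇒≡ᵇ; ≡ᵇ⇒≡; <⇒<ᵇ; <ᵇ⇒<; ≤⇒≤ᵇ; ≤ᵇ⇒≤
        ; ≤-refl; ≤-trans; ≤-pred; <⇒≤; <⇒≢; n≤1+n; m≤n+m; 1+n≰n; m≢1+n+m; m<n⇒m<1+n; m<1+n⇒m<n∨m≡n)
open import Data.Product using (∃-syntax; _×_; _,_; proj₁; proj₂)
open import Data.Sum using (_⊎_; inj₁; inj₂)
open import Data.Unit using (tt)
open import Data.Vec using ([]; _∷_)
open import Function using (_∘_; const; _⇔_; mk⇔; Equivalence)
open import Function.Properties.Equivalence using () renaming (trans to ⇔-trans; sym to ⇔-sym)
open import Relation.Binary.Bundles using (Setoid)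
open import Relation.Binary.PropositionalEquality
  using (_≡_; refl; sym; trans; cong; cong₂; subst; _≗_; _→-setoid_)

open Setoid (ℕ →-setoid ℕ) using () renaming (refl to ≗-refl; sym to ≗-sym; trans to ≗-trans)
open import Relation.Binary.Reasoning.Setoid (ℕ →-setoid ℕ) using (begin_; step-≈-⟩; _∎)

zeroPoly : Poly
zeroPoly _ = 0

guard : Bool → Poly → Poly
guard true  p = p
guard false p = zeroPoly

byBit : Poly → Poly → Poly
byBit p q = X· p ⊕ q

sumOverBits² : (Bool → Bool → Poly) → Poly
sumOverBits² f = byBit (byBit (f true true) (f true false)) (byBit (f false true) (f false false))

⊕-cong : ∀ {p p′ q q′} → p ≗ p′ → q ≗ q′ → p ⊕ q ≗ p′ ⊕ q′
⊕-cong e f i = cong₂ _+_ (e i) (f i)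

X·-cong : ∀ {p p′} → p ≗ p′ → X· p ≗ X· p′
X·-cong e zero    = refl
X·-cong e (suc i) = e i

guard-cong : ∀ b {p p′} → p ≗ p′ → guard b p ≗ guard b p′
guard-cong true  e = e
guard-cong false e = ≗-refl

guard-⊕ : ∀ b p q → guard b (p ⊕ q) ≗ guard b p ⊕ guard b q
guard-⊕ true  p q = ≗-refl
guard-⊕ false p q = ≗-refl

guard-X· : ∀ b p → guard b (X· p) ≗ X· (guard b p)
guard-X· true  p         = ≗-refl
guard-X· false p zero    = refl
guard-X· false p (suc i) = refl

byBit-cong : ∀ {p p′ q q′} → p ≗ p′ → q ≗ q′ → byBit p q ≗ byBit p′ q′
byBit-cong e f = ⊕-cong (X·-cong e) f

byBit-⊕ : ∀ p p′ q q′ → byBit (p ⊕ p′) (q ⊕ q′) ≗ byBit p q ⊕ byBit p′ q′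
byBit-⊕ p p′ q q′ zero    = refl
byBit-⊕ p p′ q q′ (suc i) = interchange +-commutativeSemigroup (p i) (p′ i) (q (suc i)) (q′ (suc i))

byBit-X· : ∀ p q → byBit (X· p) (X· q) ≗ X· (byBit p q)
byBit-X· p q zero    = refl
byBit-X· p q (suc i) = refl

sumOverBits²-cong : ∀ {f g : Bool → Bool → Poly} → (∀ y z → f y z ≗ g y z) → sumOverBits² f ≗ sumOverBits² g
sumOverBits²-cong e = byBit-cong (byBit-cong (e true true) (e true false)) (byBit-cong (e false true) (e false false))

recurrence : Poly → Poly → Poly → Poly
recurrence p q r = p ⊕ X· p ⊕ X· (X· (q ⊕ r))

recurrence-cong : ∀ {p p′ q q′ r r′} → p ≗ p′ → q ≗ q′ → r ≗ r′ → recurrence p q r ≗ recurrence p′ q′ r′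
recurrence-cong e f g = ⊕-cong (⊕-cong e (X·-cong e)) (X·-cong (X·-cong (⊕-cong f g)))

-- Counting subsets by size

count : {A : Set} → (A → Bool) → List A → ℕ
count p = length ∘ filter (T? ∘ p)

count-++ : {A : Set} (p : A → Bool) (xs ys : List A) → count p (xs ++ ys) ≡ count p xs + count p ys
count-++ p xs ys = trans (cong length (filter-++ (T? ∘ p) xs ys)) (length-++ (filter (T? ∘ p) xs))

count-map : {A B : Set} (p : B → Bool) (f : A → B) (xs : List A) → count p (map f xs) ≡ count (p ∘ f) xs
count-map p f []       = refl
count-map p f (x ∷ xs) with p (f x)
... | true  = cong suc (count-map p f xs)
... | false = count-map p f xs

count-cong : {A : Set} {p q : A → Bool} → p ≗ q → count p ≗ count q
count-cong e []       = refl
count-cong {p = p} {q} e (x ∷ xs) with p x | q x | e x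
... | true  | true  | refl = cong suc (count-cong e xs)
... | false | false | refl = count-cong e xs

count-none : {A : Set} {p : A → Bool} → (∀ x → p x ≡ false) → (xs : List A) → count p xs ≡ 0
count-none e []       = refl
count-none {p = p} e (x ∷ xs) with p x | e x
... | false | refl = count-none e xs

sizePoly : (m : ℕ) → (Subset m → Bool) → Poly
sizePoly m P i = count (λ D → P D ∧ (card D ≡ᵇ i)) (allSubsets m)

sizePoly-cong : ∀ m {P Q : Subset m → Bool} → P ≗ Q → sizePoly m P ≗ sizePoly m Q
sizePoly-cong m e i = count-cong (λ D → cong (_∧ (card D ≡ᵇ i)) (e D)) (allSubsets m)

sizePoly-cast : ∀ {m m′ N N′} → m ≡ m′ → N ≡ N′ → (P : ℕ → ∀ {k} → Subset k → Bool) →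
  sizePoly m (P N) ≗ sizePoly m′ (P N′)
sizePoly-cast refl refl P = ≗-refl

sizePoly-guard : ∀ m b (P : Subset m → Bool) → sizePoly m (λ D → b ∧ P D) ≗ guard b (sizePoly m P)
sizePoly-guard m true  P i = refl
sizePoly-guard m false P i = count-none (λ _ → refl) (allSubsets m)

sizePoly-suc : ∀ m (P : Subset (suc m) → Bool) →
  sizePoly (suc m) P ≗ byBit (sizePoly m (P ∘ (true ∷_))) (sizePoly m (P ∘ (false ∷_)))
sizePoly-suc m P i =
  trans (count-++ p (map (true ∷_) Ds) (map (false ∷_) Ds))
        (cong₂ _+_ (trans (count-map p (true ∷_) Ds) (withTrue i)) (count-map p (false ∷_) Ds))
  where
  Ds : List (Subset m)
  Ds = allSubsets m
  p : Subset (suc m) → Bool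
  p D = P D ∧ (card D ≡ᵇ i)
  withTrue : ∀ i → count (λ D → P (true ∷ D) ∧ (suc (card D) ≡ᵇ i)) Ds ≡ X· (sizePoly m (P ∘ (true ∷_))) i
  withTrue zero    = count-none (λ D → ∧-zeroʳ (P (true ∷ D))) Ds
  withTrue (suc i) = refl

sizePoly-suc² : ∀ m (P : Subset (suc (suc m)) → Bool) →
  sizePoly (suc (suc m)) P ≗ sumOverBits² (λ y z → sizePoly m (λ E → P (y ∷ z ∷ E)))
sizePoly-suc² m P = ≗-trans (sizePoly-suc (suc m) P)
  (byBit-cong (sizePoly-suc m (P ∘ (true ∷_))) (sizePoly-suc m (P ∘ (false ∷_))))

-- Linear maps on families of polynomials

Family : Set
Family = Bool → Bool → Bool → Poly

_⊕F_ : Family → Family → Family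
(F ⊕F F′) a b c = F a b c ⊕ F′ a b c

X·F : Family → Family
X·F F a b c = X· (F a b c)

_≗F_ : Family → Family → Set
F ≗F F′ = ∀ a b c → F a b c ≗ F′ a b c

recurrenceF : Family → Family → Family → Family
recurrenceF F G H a b c = recurrence (F a b c) (G a b c) (H a b c)

record IsLinear (L : Family → Poly) : Set where
  field
    L-cong : ∀ {F F′} → F ≗F F′ → L F ≗ L F′
    L-⊕    : ∀ F F′ → L (F ⊕F F′) ≗ L F ⊕ L F′
    L-X·   : ∀ F → L (X·F F) ≗ X· (L F)

at-linear : ∀ a b c → IsLinear (λ F → F a b c)
at-linear a b c = record { L-cong = λ e → e a b c ; L-⊕ = λ _ _ → ≗-refl ; L-X· = λ _ → ≗-refl }

guard-linear : ∀ b {L} → IsLinear L → IsLinear (guard b ∘ L)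
guard-linear b {L} lin = record
  { L-cong = λ e → guard-cong b (L-cong e)
  ; L-⊕    = λ F F′ → ≗-trans (guard-cong b (L-⊕ F F′)) (guard-⊕ b (L F) (L F′))
  ; L-X·   = λ F → ≗-trans (guard-cong b (L-X· F)) (guard-X· b (L F))
  }
  where open IsLinear lin

byBit-linear : ∀ {L M} → IsLinear L → IsLinear M → IsLinear (λ F → byBit (L F) (M F))
byBit-linear {L} {M} linL linM = record
  { L-cong = λ e → byBit-cong (L.L-cong e) (M.L-cong e)
  ; L-⊕    = λ F F′ → ≗-trans (byBit-cong (L.L-⊕ F F′) (M.L-⊕ F F′)) (byBit-⊕ (L F) (L F′) (M F) (M F′))
  ; L-X·   = λ F → ≗-trans (byBit-cong (L.L-X· F) (M.L-X· F)) (byBit-X· (L F) (M F))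
  }
  where
  module L = IsLinear linL
  module M = IsLinear linM

sumOverBits²-linear : ∀ {L : Family → Bool → Bool → Poly} → (∀ y z → IsLinear (λ F → L F y z)) →
  IsLinear (λ F → sumOverBits² (L F))
sumOverBits²-linear lin = byBit-linear (byBit-linear (lin true true) (lin true false))
                                       (byBit-linear (lin false true) (lin false false))

linear-recurrence : ∀ {L} → IsLinear L → ∀ F G H → L (recurrenceF F G H) ≗ recurrence (L F) (L G) (L H)
linear-recurrence {L} lin F G H =
  ≗-trans (L-⊕ (F ⊕F X·F F) (X·F (X·F (G ⊕F H))))
    (⊕-cong (≗-trans (L-⊕ F (X·F F)) (⊕-cong ≗-refl (L-X· F)))
            (≗-trans (L-X· (X·F (G ⊕F H))) (X·-cong (≗-trans (L-X· (G ⊕F H)) (X·-cong (L-⊕ G H))))))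
  where open IsLinear lin

-- Total domination as a scan along the chain

bitAt : ∀ {m} → Subset m → ℕ → Bool
bitAt []      _       = false
bitAt (b ∷ _) zero    = b
bitAt (_ ∷ D) (suc k) = bitAt D k

pad : ∀ {m} → Subset m → ℕ → Bool
pad D = bitAt (false ∷ false ∷ D)

-- P k is the bit of vertex v + k − 2 for the vertex v being checked; in T_n every vertex is
-- adjacent to v ± 1, and an even one (a vertex shared by two triangles) also to v ± 2.
locallyDominated : Bool → (ℕ → Bool) → Bool
locallyDominated even P = (even ∧ (P 0 ∨ P 4)) ∨ (P 1 ∨ P 3)

scan : ℕ → Bool → ((ℕ → Bool) → Bool) → (ℕ → Bool) → Bool
scan zero    even end P = end P
scan (suc N) even end P = locallyDominated even P ∧ scan N (not even) end (P ∘ suc)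

-- The last vertices of G_n: P k is the bit of vertex 2n − 3 + k, so that P 4 is the pendant
-- vertex 2n + 1, adjacent to 2n − 1 only.
pendantEnd : (ℕ → Bool) → Bool
pendantEnd P = ((P 1 ∨ P 3) ∨ P 4) ∧ ((P 1 ∨ P 2) ∧ P 2)

∧-intro : ∀ {a b} → IsTrue a → IsTrue b → IsTrue (a ∧ b)
∧-intro p q = Equivalence.from T-∧ (p , q)

∨-introˡ : ∀ {a b} → IsTrue a → IsTrue (a ∨ b)
∨-introˡ p = Equivalence.from T-∨ (inj₁ p)

∨-introʳ : ∀ {a b} → IsTrue b → IsTrue (a ∨ b)
∨-introʳ {a} p = Equivalence.from (T-∨ {a}) (inj₂ p)

T-ext : ∀ {a b} → (IsTrue a → IsTrue b) → (IsTrue b → IsTrue a) → a ≡ b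
T-ext {true}  {true}  _ _ = refl
T-ext {true}  {false} f _ = ⊥-elim (f tt)
T-ext {false} {true}  _ g = ⊥-elim (g tt)
T-ext {false} {false} _ _ = refl

Dominated : ∀ {m} → Subset m → (ℕ → ℕ → Bool) → ℕ → Set
Dominated D A v = ∃[ u ] IsTrue (bitAt D u) × IsTrue (A u v)

member≡bitAt : ∀ {m} (D : Subset m) (u : Fin m) → member D u ≡ bitAt D (toℕ u)
member≡bitAt (_ ∷ D) Fin.zero    = refl
member≡bitAt (_ ∷ D) (Fin.suc u) = member≡bitAt D u

bitAt-< : ∀ {m} (D : Subset m) u → IsTrue (bitAt D u) → u < m
bitAt-< (_ ∷ D) zero    _ = s≤s z≤n
bitAt-< (_ ∷ D) (suc u) p = s≤s (bitAt-< D u p)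

isTotalDominating⇔ : ∀ {m} (A : ℕ → ℕ → Bool) (D : Subset m) →
  IsTrue (isTotalDominating (mkGraph m (λ u v → A (toℕ u) (toℕ v))) D) ⇔ (∀ v → v < m → Dominated D A v)
isTotalDominating⇔ {m} A D = mk⇔ to from
  where
  dominates : Fin m → Fin m → Bool
  dominates v u = member D u ∧ A (toℕ u) (toℕ v)
  witness : ∀ {v} → ∃[ u ] IsTrue (dominates v u) → Dominated D A (toℕ v)
  witness (u , p) with Equivalence.to T-∧ p
  ... | du , a = toℕ u , subst IsTrue (member≡bitAt D u) du , a
  to : IsTrue (all (λ v → any (dominates v) (allFinL m)) (allFinL m)) → ∀ v → v < m → Dominated D A v
  to h v v<m = subst (Dominated D A) (toℕ-fromℕ< v<m)
    (witness (satisfied (any⁻ (dominates v′) (allFinL m) (All.lookup (all⁺ _ (allFinL m) h) (∈-allFin v′)))))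
    where
    v′ : Fin m
    v′ = fromℕ< v<m
  from : (∀ v → v < m → Dominated D A v) → IsTrue (all (λ v → any (dominates v) (allFinL m)) (allFinL m))
  from h = all⁻ _ {allFinL m} (All.tabulate λ {v} _ → covered v (h (toℕ v) (toℕ<n v)))
    where
    covered : ∀ v → Dominated D A (toℕ v) → IsTrue (any (dominates v) (allFinL m))
    covered v (u , du , a) = any⁺ (dominates v) (lose (∈-allFin u′) (∧-intro du′ a′))
      where
      u<m : u < m
      u<m = bitAt-< D u du
      u′ : Fin m
      u′ = fromℕ< u<m
      du′ : IsTrue (member D u′)
      du′ = subst IsTrue (sym (trans (member≡bitAt D u′) (cong (bitAt D) (toℕ-fromℕ< u<m)))) du
      a′ : IsTrue (A (toℕ u′) (toℕ v))
      a′ = subst (λ w → IsTrue (A w (toℕ v))) (sym (toℕ-fromℕ< u<m)) a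

-- k + v rather than v + k, so that window P v k reduces to P (suc … (suc v)) for a literal k.
window : (ℕ → Bool) → ℕ → ℕ → Bool
window P v k = P (k + v)

window-suc : ∀ P v → window (P ∘ suc) v ≗ window P (suc v)
window-suc P v k = cong P (sym (+-suc k v))

locallyDominated-cong : ∀ e {P Q} → P ≗ Q → locallyDominated e P ≡ locallyDominated e Q
locallyDominated-cong e eq rewrite eq 0 | eq 1 | eq 3 | eq 4 = refl

Extensional : ((ℕ → Bool) → Bool) → Set
Extensional end = ∀ {P Q} → P ≗ Q → end P ≡ end Q

pendantEnd-ext : Extensional pendantEnd
pendantEnd-ext eq rewrite eq 1 | eq 2 | eq 3 | eq 4 = refl

flips : ℕ → Bool → Bool
flips zero    e = e
flips (suc v) e = flips v (not e)

flips-true : ∀ v → flips v true ≡ evenᵇ v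
flips-true zero          = refl
flips-true (suc zero)    = refl
flips-true (suc (suc v)) = flips-true v

scan⇔ : ∀ {end} → Extensional end → ∀ N e P →
  IsTrue (scan N e end P) ⇔
    ((∀ v → v < N → IsTrue (locallyDominated (flips v e) (window P v))) × IsTrue (end (window P N)))
scan⇔ ext zero e P = mk⇔ (λ h → (λ _ ()) , subst IsTrue (ext P≗) h) (subst IsTrue (sym (ext P≗)) ∘ proj₂)
  where
  P≗ : P ≗ window P 0
  P≗ k = cong P (sym (+-identityʳ k))
scan⇔ {end} ext (suc N) e P = mk⇔ to from
  where
  rest : IsTrue (scan N (not e) end (P ∘ suc)) ⇔
         ((∀ v → v < N → IsTrue (locallyDominated (flips v (not e)) (window (P ∘ suc) v))) ×
          IsTrue (end (window (P ∘ suc) N)))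
  rest = scan⇔ ext N (not e) (P ∘ suc)
  Spec : Set
  Spec = (∀ v → v < suc N → IsTrue (locallyDominated (flips v e) (window P v))) × IsTrue (end (window P (suc N)))
  shift : ∀ v → locallyDominated (flips v (not e)) (window (P ∘ suc) v)
              ≡ locallyDominated (flips (suc v) e) (window P (suc v))
  shift v = locallyDominated-cong (flips v (not e)) (window-suc P v)
  to : IsTrue (scan (suc N) e end P) → Spec
  to h with Equivalence.to T-∧ h
  ... | here , later with Equivalence.to rest later
  ...   | local , final = everywhere , subst IsTrue (ext (window-suc P N)) final
    where
    everywhere : ∀ v → v < suc N → IsTrue (locallyDominated (flips v e) (window P v))
    everywhere zero    _         = here
    everywhere (suc v) (s≤s v<N) = subst IsTrue (shift v) (local v v<N)
  from : Spec → IsTrue (scan (suc N) e end P)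
  from (local , final) = ∧-intro (local 0 (s≤s z≤n))
    (Equivalence.from rest ((λ v v<N → subst IsTrue (sym (shift v)) (local (suc v) (s≤s v<N))) ,
                            subst IsTrue (sym (ext (window-suc P N))) final))

scan-even⇔ : ∀ {end} → Extensional end → ∀ N P →
  IsTrue (scan N true end P) ⇔
    ((∀ v → v < N → IsTrue (locallyDominated (evenᵇ v) (window P v))) × IsTrue (end (window P N)))
scan-even⇔ ext N P = ⇔-trans (scan⇔ ext N true P)
  (mk⇔ (λ (l , e) → (λ v v<N → parity v (l v v<N)) , e) (λ (l , e) → (λ v v<N → parity′ v (l v v<N)) , e))
  where
  parity : ∀ v → IsTrue (locallyDominated (flips v true) (window P v)) → IsTrue (locallyDominated (evenᵇ v) (window P v))
  parity v = subst (λ b → IsTrue (locallyDominated b (window P v))) (flips-true v)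
  parity′ : ∀ v → IsTrue (locallyDominated (evenᵇ v) (window P v)) → IsTrue (locallyDominated (flips v true) (window P v))
  parity′ v = subst (λ b → IsTrue (locallyDominated b (window P v))) (sym (flips-true v))

isTotalDominating≡scan : ∀ {m} (A : ℕ → ℕ → Bool) (D : Subset m) N {end} → Extensional end →
  ((∀ v → v < m → Dominated D A v) ⇔
     ((∀ v → v < N → IsTrue (locallyDominated (evenᵇ v) (window (pad D) v))) × IsTrue (end (window (pad D) N)))) →
  isTotalDominating (mkGraph m (λ u v → A (toℕ u) (toℕ v))) D ≡ scan N true end (pad D)
isTotalDominating≡scan {m} A D N {end} ext local = T-ext (Equivalence.to equiv) (Equivalence.from equiv)
  where
  equiv : IsTrue (isTotalDominating (mkGraph m (λ u v → A (toℕ u) (toℕ v))) D) ⇔ IsTrue (scan N true end (pad D))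
  equiv = ⇔-trans (isTotalDominating⇔ A D) (⇔-trans local (⇔-sym (scan-even⇔ ext N (pad D))))

-- Neighbourhoods in T_n

data ChainEdge (u v : ℕ) : Set where
  step  : suc u ≡ v → ChainEdge u v
  step⁻ : suc v ≡ u → ChainEdge u v
  jump  : IsTrue (evenᵇ u) → suc (suc u) ≡ v → ChainEdge u v
  jump⁻ : IsTrue (evenᵇ v) → suc (suc v) ≡ u → ChainEdge u v

chainEdge-≤ : ∀ {u v} → ChainEdge u v → u ≤ suc (suc v)
chainEdge-≤ (step refl)    = m≤n+m _ 3
chainEdge-≤ (step⁻ refl)   = n≤1+n _
chainEdge-≤ (jump _ refl)  = m≤n+m _ 4
chainEdge-≤ (jump⁻ _ refl) = ≤-refl

edgeLt⇔ : ∀ n u v → IsTrue (edgeLt n u v) ⇔ (v ≤ 2 * n × (suc u ≡ v ⊎ IsTrue (evenᵇ u) × suc (suc u) ≡ v))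
edgeLt⇔ n u v = mk⇔ to from
  where
  to : IsTrue (edgeLt n u v) → v ≤ 2 * n × (suc u ≡ v ⊎ IsTrue (evenᵇ u) × suc (suc u) ≡ v)
  to h with Equivalence.to T-∧ h
  ... | v≤ , e with Equivalence.to (T-∨ {v ≡ᵇ suc u}) e
  ...   | inj₁ q = ≤ᵇ⇒≤ v (2 * n) v≤ , inj₁ (sym (≡ᵇ⇒≡ v (suc u) q))
  ...   | inj₂ q with Equivalence.to T-∧ q
  ...     | ev , q′ = ≤ᵇ⇒≤ v (2 * n) v≤ , inj₂ (ev , sym (≡ᵇ⇒≡ v (suc (suc u)) q′))
  from : v ≤ 2 * n × (suc u ≡ v ⊎ IsTrue (evenᵇ u) × suc (suc u) ≡ v) → IsTrue (edgeLt n u v)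
  from (v≤ , inj₁ refl)        = ∧-intro (≤⇒≤ᵇ v≤) (∨-introˡ (≡⇒≡ᵇ v v refl))
  from (v≤ , inj₂ (ev , refl)) = ∧-intro (≤⇒≤ᵇ v≤) (∨-introʳ {suc u ≡ᵇ u} (∧-intro ev (≡⇒≡ᵇ v v refl)))

tAdj⇔ : ∀ n u v → IsTrue (tAdj n u v) ⇔ (u ≤ 2 * n × v ≤ 2 * n × ChainEdge u v)
tAdj⇔ n u v = mk⇔ to from
  where
  to : IsTrue (tAdj n u v) → u ≤ 2 * n × v ≤ 2 * n × ChainEdge u v
  to h with Equivalence.to (T-∨ {(u <ᵇ v) ∧ edgeLt n u v}) h
  ... | inj₁ q with Equivalence.to T-∧ q
  ...   | u<v , e with Equivalence.to (edgeLt⇔ n u v) e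
  ...     | v≤ , inj₁ eq        = ≤-trans (<⇒≤ (<ᵇ⇒< u v u<v)) v≤ , v≤ , step eq
  ...     | v≤ , inj₂ (ev , eq) = ≤-trans (<⇒≤ (<ᵇ⇒< u v u<v)) v≤ , v≤ , jump ev eq
  to h | inj₂ q with Equivalence.to T-∧ q
  ...   | v<u , e with Equivalence.to (edgeLt⇔ n v u) e
  ...     | u≤ , inj₁ eq        = u≤ , ≤-trans (<⇒≤ (<ᵇ⇒< v u v<u)) u≤ , step⁻ eq
  ...     | u≤ , inj₂ (ev , eq) = u≤ , ≤-trans (<⇒≤ (<ᵇ⇒< v u v<u)) u≤ , jump⁻ ev eq
  forward : u < v → IsTrue (edgeLt n u v) → IsTrue (tAdj n u v)
  forward u<v e = ∨-introˡ (∧-intro (<⇒<ᵇ u<v) e)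
  backward : v < u → IsTrue (edgeLt n v u) → IsTrue (tAdj n u v)
  backward v<u e = ∨-introʳ {(u <ᵇ v) ∧ edgeLt n u v} (∧-intro (<⇒<ᵇ v<u) e)
  from : u ≤ 2 * n × v ≤ 2 * n × ChainEdge u v → IsTrue (tAdj n u v)
  from (u≤ , v≤ , step refl)     = forward ≤-refl (Equivalence.from (edgeLt⇔ n u v) (v≤ , inj₁ refl))
  from (u≤ , v≤ , step⁻ refl)    = backward ≤-refl (Equivalence.from (edgeLt⇔ n v u) (u≤ , inj₁ refl))
  from (u≤ , v≤ , jump ev refl)  = forward (s≤s (n≤1+n u)) (Equivalence.from (edgeLt⇔ n u v) (v≤ , inj₂ (ev , refl)))
  from (u≤ , v≤ , jump⁻ ev refl) = backward (s≤s (n≤1+n v)) (Equivalence.from (edgeLt⇔ n v u) (u≤ , inj₂ (ev , refl)))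

chainEdge⇒local : ∀ {m} (D : Subset m) {u v} → ChainEdge u v → IsTrue (bitAt D u) →
  IsTrue (locallyDominated (evenᵇ v) (window (pad D) v))
chainEdge⇒local D {u} (step refl)         du = ∨-introʳ {evenᵇ (suc u) ∧ _} (∨-introˡ du)
chainEdge⇒local D {v = v} (step⁻ refl)    du = ∨-introʳ {evenᵇ v ∧ _} (∨-introʳ {pad D (suc v)} du)
chainEdge⇒local D (jump ev refl)          du = ∨-introˡ (∧-intro ev (∨-introˡ du))
chainEdge⇒local D {v = v} (jump⁻ ev refl) du = ∨-introˡ (∧-intro ev (∨-introʳ {pad D v} du))

bitAt-pred : ∀ {m} (D : Subset m) v → IsTrue (bitAt (false ∷ D) v) → ∃[ u ] suc u ≡ v × IsTrue (bitAt D u)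
bitAt-pred D (suc u) du = u , refl , du

local⇒chainEdge : ∀ {m} (D : Subset m) v → IsTrue (locallyDominated (evenᵇ v) (window (pad D) v)) →
  ∃[ u ] IsTrue (bitAt D u) × ChainEdge u v
local⇒chainEdge D v h with Equivalence.to (T-∨ {evenᵇ v ∧ _}) h
... | inj₁ q with Equivalence.to T-∧ q
...   | ev , p with Equivalence.to (T-∨ {pad D v}) p
...     | inj₁ d with bitAt-pred (false ∷ D) v d
...       | w , refl , d′ with bitAt-pred D w d′
...         | u , refl , du = u , du , jump ev refl
local⇒chainEdge D v h | inj₁ q | ev , p | inj₂ du = suc (suc v) , du , jump⁻ ev refl
local⇒chainEdge D v h | inj₂ q with Equivalence.to (T-∨ {pad D (suc v)}) q
... | inj₁ d with bitAt-pred D v d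
...   | u , refl , du = u , du , step refl
local⇒chainEdge D v h | inj₂ q | inj₂ du = suc v , du , step⁻ refl

dominated-T⇔ : ∀ n (D : Subset (suc (2 * n))) v → v ≤ 2 * n →
  Dominated D (tAdj n) v ⇔ IsTrue (locallyDominated (evenᵇ v) (window (pad D) v))
dominated-T⇔ n D v v≤ = mk⇔ to from
  where
  to : Dominated D (tAdj n) v → IsTrue (locallyDominated (evenᵇ v) (window (pad D) v))
  to (u , du , a) = chainEdge⇒local D (proj₂ (proj₂ (Equivalence.to (tAdj⇔ n u v) a))) du
  from : IsTrue (locallyDominated (evenᵇ v) (window (pad D) v)) → Dominated D (tAdj n) v
  from h with local⇒chainEdge D v h
  ... | u , du , e = u , du , Equivalence.from (tAdj⇔ n u v) (≤-pred (bitAt-< D u du) , v≤ , e)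

isTotalDominating-T : ∀ n (D : Subset (suc (2 * n))) →
  isTotalDominating (T n) D ≡ scan (suc (2 * n)) true (const true) (pad D)
isTotalDominating-T n D = isTotalDominating≡scan (tAdj n) D (suc (2 * n)) (λ _ → refl) (mk⇔
  (λ h → (λ v v< → Equivalence.to (dominated-T⇔ n D v (≤-pred v<)) (h v v<)) , tt)
  (λ (l , _) v v< → Equivalence.from (dominated-T⇔ n D v (≤-pred v<)) (l v v<)))

-- Neighbourhoods in G_n

double : ℕ → ℕ
double zero    = zero
double (suc k) = suc (suc (double k))

2*≡double : ∀ k → 2 * k ≡ double k
2*≡double zero    = refl
2*≡double (suc k) = cong suc (trans (+-suc k (k + 0)) (cong suc (2*≡double k)))

evenᵇ-double : ∀ k → IsTrue (evenᵇ (double k))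
evenᵇ-double zero    = tt
evenᵇ-double (suc k) = evenᵇ-double k

evenᵇ-suc-double : ∀ k → evenᵇ (suc (double k)) ≡ false
evenᵇ-suc-double zero    = refl
evenᵇ-suc-double (suc k) = evenᵇ-suc-double k

pendAdj⇔ : ∀ n u v → IsTrue (pendAdj n u v) ⇔
  ((u ≡ suc (2 * n) × v ≡ 2 * n ∸ 1) ⊎ (v ≡ suc (2 * n) × u ≡ 2 * n ∸ 1))
pendAdj⇔ n u v = mk⇔ to from
  where
  to : IsTrue (pendAdj n u v) → (u ≡ suc (2 * n) × v ≡ 2 * n ∸ 1) ⊎ (v ≡ suc (2 * n) × u ≡ 2 * n ∸ 1)
  to h with Equivalence.to (T-∨ {(u ≡ᵇ suc (2 * n)) ∧ (v ≡ᵇ (2 * n ∸ 1))}) h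
  ... | inj₁ q with Equivalence.to T-∧ q
  ...   | p , p′ = inj₁ (≡ᵇ⇒≡ u _ p , ≡ᵇ⇒≡ v _ p′)
  to h | inj₂ q with Equivalence.to T-∧ q
  ...   | p , p′ = inj₂ (≡ᵇ⇒≡ v _ p , ≡ᵇ⇒≡ u _ p′)
  from : (u ≡ suc (2 * n) × v ≡ 2 * n ∸ 1) ⊎ (v ≡ suc (2 * n) × u ≡ 2 * n ∸ 1) → IsTrue (pendAdj n u v)
  from (inj₁ (refl , refl)) = ∨-introˡ (∧-intro (≡⇒≡ᵇ u u refl) (≡⇒≡ᵇ v v refl))
  from (inj₂ (refl , refl)) =
    ∨-introʳ {(u ≡ᵇ suc (2 * n)) ∧ (v ≡ᵇ (2 * n ∸ 1))} (∧-intro (≡⇒≡ᵇ v v refl) (≡⇒≡ᵇ u u refl))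

-- G_{k+1}, with W = 2k + 1 the vertex carrying the pendant W + 2 and W + 1 the last vertex of T_{k+1}.
module PendantChain (k : ℕ) {m : ℕ} (D : Subset m) where

  W : ℕ
  W = suc (double k)

  A : ℕ → ℕ → Bool
  A u v = tAdj (suc k) u v ∨ pendAdj (suc k) u v

  2n≡ : 2 * suc k ≡ suc W
  2n≡ = 2*≡double (suc k)

  data Edge (u v : ℕ) : Set where
    chain    : u ≤ suc W → v ≤ suc W → ChainEdge u v → Edge u v
    pendant  : u ≡ suc (suc W) → v ≡ W → Edge u v
    pendant⁻ : v ≡ suc (suc W) → u ≡ W → Edge u v

  edge⇔ : ∀ u v → IsTrue (A u v) ⇔ Edge u v
  edge⇔ u v = mk⇔ to from
    where
    to : IsTrue (A u v) → Edge u v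
    to h with Equivalence.to (T-∨ {tAdj (suc k) u v}) h
    ... | inj₁ t with Equivalence.to (tAdj⇔ (suc k) u v) t
    ...   | u≤ , v≤ , e = chain (subst (u ≤_) 2n≡ u≤) (subst (v ≤_) 2n≡ v≤) e
    to h | inj₂ p with Equivalence.to (pendAdj⇔ (suc k) u v) p
    ...   | inj₁ (eu , ev) = pendant (trans eu (cong suc 2n≡)) (trans ev (cong (_∸ 1) 2n≡))
    ...   | inj₂ (ev , eu) = pendant⁻ (trans ev (cong suc 2n≡)) (trans eu (cong (_∸ 1) 2n≡))
    from : Edge u v → IsTrue (A u v)
    from (chain u≤ v≤ e)  = ∨-introˡ (Equivalence.from (tAdj⇔ (suc k) u v)
                              (subst (u ≤_) (sym 2n≡) u≤ , subst (v ≤_) (sym 2n≡) v≤ , e))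
    from (pendant eu ev)  = ∨-introʳ {tAdj (suc k) u v} (Equivalence.from (pendAdj⇔ (suc k) u v)
                              (inj₁ (trans eu (cong suc (sym 2n≡)) , trans ev (cong (_∸ 1) (sym 2n≡)))))
    from (pendant⁻ ev eu) = ∨-introʳ {tAdj (suc k) u v} (Equivalence.from (pendAdj⇔ (suc k) u v)
                              (inj₂ (trans ev (cong suc (sym 2n≡)) , trans eu (cong (_∸ 1) (sym 2n≡)))))

  DominatedG : ℕ → Set
  DominatedG = Dominated D A

  edge : ∀ {u v} → IsTrue (bitAt D u) → Edge u v → DominatedG v
  edge {u} {v} du e = u , du , Equivalence.from (edge⇔ u v) e

  below-W⇔ : ∀ v → v < W → DominatedG v ⇔ IsTrue (locallyDominated (evenᵇ v) (window (pad D) v))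
  below-W⇔ v v<W = mk⇔ to from
    where
    to : DominatedG v → IsTrue (locallyDominated (evenᵇ v) (window (pad D) v))
    to (u , du , a) with Equivalence.to (edge⇔ u v) a
    ... | chain _ _ e     = chainEdge⇒local D e du
    ... | pendant _ refl  = ⊥-elim (<⇒≢ v<W refl)
    ... | pendant⁻ refl _ = ⊥-elim (<⇒≢ (m<n⇒m<1+n (m<n⇒m<1+n v<W)) refl)
    from : IsTrue (locallyDominated (evenᵇ v) (window (pad D) v)) → DominatedG v
    from h with local⇒chainEdge D v h
    ... | u , du , e = edge du (chain (≤-trans (chainEdge-≤ e) (s≤s v<W)) (≤-trans (<⇒≤ v<W) (n≤1+n W)) e)

  at-W⇔ : DominatedG W ⇔ IsTrue ((bitAt D (double k) ∨ bitAt D (suc W)) ∨ bitAt D (suc (suc W)))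
  at-W⇔ = mk⇔ to from
    where
    to : DominatedG W → IsTrue ((bitAt D (double k) ∨ bitAt D (suc W)) ∨ bitAt D (suc (suc W)))
    to (u , du , a) with Equivalence.to (edge⇔ u W) a
    ... | chain _ _ e    = ∨-introˡ (subst (λ b → IsTrue (locallyDominated b (window (pad D) W)))
                                           (evenᵇ-suc-double k) (chainEdge⇒local D e du))
    ... | pendant refl _ = ∨-introʳ {bitAt D (double k) ∨ bitAt D (suc W)} du
    ... | pendant⁻ eq _  = ⊥-elim (m≢1+n+m W {1} eq)
    from : IsTrue ((bitAt D (double k) ∨ bitAt D (suc W)) ∨ bitAt D (suc (suc W))) → DominatedG W
    from h with Equivalence.to (T-∨ {bitAt D (double k) ∨ bitAt D (suc W)}) h
    ... | inj₂ d = edge d (pendant refl refl)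
    ... | inj₁ q with Equivalence.to (T-∨ {bitAt D (double k)}) q
    ...   | inj₁ d = edge d (chain (≤-trans (n≤1+n _) (n≤1+n _)) (n≤1+n W) (step refl))
    ...   | inj₂ d = edge d (chain ≤-refl (n≤1+n W) (step⁻ refl))

  at-2n⇔ : DominatedG (suc W) ⇔ IsTrue (bitAt D (double k) ∨ bitAt D W)
  at-2n⇔ = mk⇔ to from
    where
    to : DominatedG (suc W) → IsTrue (bitAt D (double k) ∨ bitAt D W)
    to (u , du , a) with Equivalence.to (edge⇔ u (suc W)) a
    ... | chain _ _ (step refl)     = ∨-introʳ {bitAt D (double k)} du
    ... | chain u≤ _ (step⁻ refl)   = ⊥-elim (1+n≰n u≤)
    ... | chain _ _ (jump _ refl)   = ∨-introˡ du
    ... | chain u≤ _ (jump⁻ _ refl) = ⊥-elim (1+n≰n (≤-trans (n≤1+n _) u≤))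
    ... | pendant _ eq              = ⊥-elim (m≢1+n+m W {0} (sym eq))
    ... | pendant⁻ eq _             = ⊥-elim (m≢1+n+m (suc W) {0} eq)
    from : IsTrue (bitAt D (double k) ∨ bitAt D W) → DominatedG (suc W)
    from h with Equivalence.to (T-∨ {bitAt D (double k)}) h
    ... | inj₁ d = edge d (chain (≤-trans (n≤1+n _) (n≤1+n _)) ≤-refl (jump (evenᵇ-double k) refl))
    ... | inj₂ d = edge d (chain (n≤1+n W) ≤-refl (step refl))

  at-pendant⇔ : DominatedG (suc (suc W)) ⇔ IsTrue (bitAt D W)
  at-pendant⇔ = mk⇔ to from
    where
    to : DominatedG (suc (suc W)) → IsTrue (bitAt D W)
    to (u , du , a) with Equivalence.to (edge⇔ u (suc (suc W))) a
    ... | chain _ v≤ _    = ⊥-elim (1+n≰n v≤)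
    ... | pendant _ eq    = ⊥-elim (m≢1+n+m W {1} (sym eq))
    ... | pendant⁻ _ refl = du
    from : IsTrue (bitAt D W) → DominatedG (suc (suc W))
    from d = edge d (pendant⁻ refl refl)

  AllDominated AllLocal : Set
  AllDominated = ∀ v → v < suc (suc (2 * suc k)) → DominatedG v
  AllLocal = ∀ v → v < W → IsTrue (locallyDominated (evenᵇ v) (window (pad D) v))

  allDominated⇔ : AllDominated ⇔ (AllLocal × IsTrue (pendantEnd (window (pad D) W)))
  allDominated⇔ = mk⇔ to from
    where
    to : AllDominated → AllLocal × IsTrue (pendantEnd (window (pad D) W))
    to h = (λ v v<W → Equivalence.to (below-W⇔ v v<W) (h′ v (m<n⇒m<1+n (m<n⇒m<1+n (m<n⇒m<1+n v<W))))) ,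
           ∧-intro (Equivalence.to at-W⇔ (h′ W (m<n⇒m<1+n (m<n⇒m<1+n ≤-refl))))
             (∧-intro (Equivalence.to at-2n⇔ (h′ (suc W) (m<n⇒m<1+n ≤-refl)))
                      (Equivalence.to at-pendant⇔ (h′ (suc (suc W)) ≤-refl)))
      where
      h′ : ∀ v → v < suc (suc (suc W)) → DominatedG v
      h′ v v< = h v (subst (v <_) (cong (suc ∘ suc) (sym 2n≡)) v<)
    from : AllLocal × IsTrue (pendantEnd (window (pad D) W)) → AllDominated
    from (local , end) v v<
      with Equivalence.to (T-∧ {(bitAt D (double k) ∨ bitAt D (suc W)) ∨ bitAt D (suc (suc W))}) end
    ... | dW , rest with Equivalence.to (T-∧ {bitAt D (double k) ∨ bitAt D W}) rest
    ...   | d2n , dp with m<1+n⇒m<n∨m≡n (subst (v <_) (cong (suc ∘ suc) 2n≡) v<)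
    ...     | inj₂ refl = Equivalence.from at-pendant⇔ dp
    ...     | inj₁ v< with m<1+n⇒m<n∨m≡n v<
    ...       | inj₂ refl = Equivalence.from at-2n⇔ d2n
    ...       | inj₁ v< with m<1+n⇒m<n∨m≡n v<
    ...         | inj₂ refl = Equivalence.from at-W⇔ dW
    ...         | inj₁ v<W = Equivalence.from (below-W⇔ v v<W) (local v v<W)

isTotalDominating-G : ∀ k (D : Subset (suc (suc (2 * suc k)))) →
  isTotalDominating (G (suc k)) D ≡ scan (suc (double k)) true pendantEnd (pad D)
isTotalDominating-G k D = isTotalDominating≡scan A D W pendantEnd-ext allDominated⇔
  where open PendantChain k D

-- The transfer operator

-- chainPoly t s end m a b c counts, by size, the sets E such that (a, b, c, E) dominates every
-- vertex but a of a chain of m + 1 triangles followed by t further vertices: the double m + s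
-- vertices from b on are checked locally, the remaining ones by end. (double m comes first so
-- that these numbers reduce for suc m.)
chainPoly : (t s : ℕ) → ((ℕ → Bool) → Bool) → ℕ → Family
chainPoly t s end m a b c =
  sizePoly (double m + t) (λ E → scan (double m + s) false end (bitAt (false ∷ a ∷ b ∷ c ∷ E)))

chainT chainG : ℕ → Family
chainT = chainPoly 0 2 (const true)
chainG = chainPoly 1 0 pendantEnd

-- Prepends the triangle (a, b, c) to tails starting with (c, y, z); the guards say that b and c
-- are dominated.
extend : Family → Family
extend F a b c = sumOverBits² (λ y z → guard (a ∨ c) (guard ((a ∨ z) ∨ (b ∨ y)) (F c y z)))

-- Chooses the first triangle (x, y, z), whose vertex x is dominated by y or z.
close : Family → Poly
close F = byBit (startingWith true) (startingWith false)
  where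
  startingWith : Bool → Poly
  startingWith x = sumOverBits² (λ y z → guard (z ∨ y) (F x y z))

extend-linear : ∀ a b c → IsLinear (λ F → extend F a b c)
extend-linear a b c = sumOverBits²-linear λ y z →
  guard-linear (a ∨ c) (guard-linear ((a ∨ z) ∨ (b ∨ y)) (at-linear c y z))

close-linear : IsLinear close
close-linear = byBit-linear (startingWith true) (startingWith false)
  where
  startingWith : ∀ x → IsLinear (λ F → sumOverBits² (λ y z → guard (z ∨ y) (F x y z)))
  startingWith x = sumOverBits²-linear λ y z → guard-linear (z ∨ y) (at-linear x y z)

IgnoresFirst : ((ℕ → Bool) → Bool) → Set
IgnoresFirst end = ∀ {k} w (L : Subset k) → end (bitAt (w ∷ L)) ≡ end (bitAt (false ∷ L))

scan-ignoresFirst : ∀ {end} → IgnoresFirst end → ∀ N {k} w (L : Subset k) →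
  scan N false end (bitAt (w ∷ L)) ≡ scan N false end (bitAt (false ∷ L))
scan-ignoresFirst ignores zero    w L = ignores w L
scan-ignoresFirst ignores (suc N) w L = refl

chainPoly-suc : ∀ t s {end} → IgnoresFirst end → ∀ m → chainPoly t s end (suc m) ≗F extend (chainPoly t s end m)
chainPoly-suc t s {end} ignores m a b c =
  ≗-trans (sizePoly-suc² (double m + t) λ E → scan (suc (suc (double m + s))) false end (bitAt (false ∷ a ∷ b ∷ c ∷ E)))
          (sumOverBits²-cong prepended)
  where
  rest : Bool → Bool → Subset (double m + t) → Bool
  rest y z E = scan (double m + s) false end (bitAt (b ∷ c ∷ y ∷ z ∷ E))
  prepended : ∀ y z → sizePoly (double m + t) (λ E → (a ∨ c) ∧ (((a ∨ z) ∨ (b ∨ y)) ∧ rest y z E))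
                        ≗ guard (a ∨ c) (guard ((a ∨ z) ∨ (b ∨ y)) (chainPoly t s end m c y z))
  prepended y z =
    ≗-trans (sizePoly-guard (double m + t) (a ∨ c) λ E → ((a ∨ z) ∨ (b ∨ y)) ∧ rest y z E) (guard-cong (a ∨ c)
    (≗-trans (sizePoly-guard (double m + t) ((a ∨ z) ∨ (b ∨ y)) (rest y z)) (guard-cong ((a ∨ z) ∨ (b ∨ y))
    (sizePoly-cong (double m + t) λ E → scan-ignoresFirst ignores (double m + s) b (c ∷ y ∷ z ∷ E)))))

sizePoly-close : ∀ t s end m →
  sizePoly (3 + (double m + t)) (λ D → scan (1 + (double m + s)) true end (pad D)) ≗ close (chainPoly t s end m)
sizePoly-close t s end m = ≗-trans (sizePoly-suc (2 + (double m + t)) P) (byBit-cong (startingWith true) (startingWith false))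
  where
  P : Subset (3 + (double m + t)) → Bool
  P D = scan (1 + (double m + s)) true end (pad D)
  rest : Bool → Bool → Bool → Subset (double m + t) → Bool
  rest x y z E = scan (double m + s) false end (bitAt (false ∷ x ∷ y ∷ z ∷ E))
  startingWith : ∀ x → sizePoly (2 + (double m + t)) (λ D → P (x ∷ D))
                         ≗ sumOverBits² (λ y z → guard (z ∨ y) (chainPoly t s end m x y z))
  startingWith x = ≗-trans (sizePoly-suc² (double m + t) λ D → P (x ∷ D))
    (sumOverBits²-cong λ y z → sizePoly-guard (double m + t) (z ∨ y) (rest x y z))

Dt-T≗close : ∀ m → Dt (T (suc m)) ≗ close (chainT m)
Dt-T≗close m zero    = refl
Dt-T≗close m (suc i) = counted (suc i)
  where
  vertices : suc (2 * suc m) ≡ 3 + (double m + 0)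
  vertices = cong suc (trans (2*≡double (suc m)) (cong (2 +_) (sym (+-identityʳ (double m)))))
  windows : suc (2 * suc m) ≡ 1 + (double m + 2)
  windows = cong suc (trans (2*≡double (suc m)) (+-comm 2 (double m)))
  counted : sizePoly (suc (2 * suc m)) (isTotalDominating (T (suc m))) ≗ close (chainT m)
  counted = begin
    sizePoly (suc (2 * suc m)) (isTotalDominating (T (suc m)))
      ≈⟨ sizePoly-cong _ (isTotalDominating-T (suc m)) ⟩
    sizePoly (suc (2 * suc m)) (λ D → scan (suc (2 * suc m)) true (const true) (pad D))
      ≈⟨ sizePoly-cast vertices windows (λ N D → scan N true (const true) (pad D)) ⟩
    sizePoly (3 + (double m + 0)) (λ D → scan (1 + (double m + 2)) true (const true) (pad D))
      ≈⟨ sizePoly-close 0 2 (const true) m ⟩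
    close (chainT m) ∎

Dt-G≗close : ∀ m → Dt (G (suc m)) ≗ close (chainG m)
Dt-G≗close m zero    = refl
Dt-G≗close m (suc i) = counted (suc i)
  where
  vertices : suc (suc (2 * suc m)) ≡ 3 + (double m + 1)
  vertices = cong (suc ∘ suc) (trans (2*≡double (suc m)) (cong suc (+-comm 1 (double m))))
  windows : suc (double m) ≡ 1 + (double m + 0)
  windows = cong suc (sym (+-identityʳ (double m)))
  counted : sizePoly (suc (suc (2 * suc m))) (isTotalDominating (G (suc m))) ≗ close (chainG m)
  counted = begin
    sizePoly (suc (suc (2 * suc m))) (isTotalDominating (G (suc m)))
      ≈⟨ sizePoly-cong _ (isTotalDominating-G m) ⟩
    sizePoly (suc (suc (2 * suc m))) (λ D → scan (suc (double m)) true pendantEnd (pad D))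
      ≈⟨ sizePoly-cast vertices windows (λ N D → scan N true pendantEnd (pad D)) ⟩
    sizePoly (3 + (double m + 1)) (λ D → scan (1 + (double m + 0)) true pendantEnd (pad D))
      ≈⟨ sizePoly-close 1 0 pendantEnd m ⟩
    close (chainG m) ∎

-- The recurrence

agreeBelow : ℕ → Poly → Poly → Bool
agreeBelow zero    p q = true
agreeBelow (suc k) p q = (p 0 ≡ᵇ q 0) ∧ agreeBelow k (p ∘ suc) (q ∘ suc)

≗-byPrefix : ∀ k {p q : Poly} → IsTrue (agreeBelow k p q) → (∀ j → p (k + j) ≡ q (k + j)) → p ≗ q
≗-byPrefix zero    _  tail i = tail i
≗-byPrefix (suc k) {p} {q} ok tail zero    = ≡ᵇ⇒≡ (p 0) (q 0) (proj₁ (Equivalence.to T-∧ ok))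
≗-byPrefix (suc k) {p} {q} ok tail (suc i) =
  ≗-byPrefix k (proj₂ (Equivalence.to (T-∧ {p 0 ≡ᵇ q 0}) ok)) tail i

Dt-T3-recurrence : Dt (T 3) ≗ recurrence (Dt (G 2)) (Dt (G 1)) (Dt (G 0))
Dt-T3-recurrence = ≗-byPrefix 8 tt λ _ → refl

Dt-T4-recurrence : Dt (T 4) ≗ recurrence (Dt (G 3)) (Dt (G 2)) (Dt (G 1))
Dt-T4-recurrence = ≗-byPrefix 10 tt λ _ → refl

-- The same identity one level lower, for chainT 3, fails at (a, b, c) = (true, true, false).
chainT-4-recurrence : chainT 4 ≗F recurrenceF (chainG 3) (chainG 2) (chainG 1)
chainT-4-recurrence true  true  true  = ≗-byPrefix 9 tt λ _ → refl
chainT-4-recurrence true  true  false = ≗-byPrefix 9 tt λ _ → refl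
chainT-4-recurrence true  false true  = ≗-byPrefix 9 tt λ _ → refl
chainT-4-recurrence true  false false = ≗-byPrefix 9 tt λ _ → refl
chainT-4-recurrence false true  true  = ≗-byPrefix 9 tt λ _ → refl
chainT-4-recurrence false true  false = ≗-byPrefix 9 tt λ _ → refl
chainT-4-recurrence false false true  = ≗-byPrefix 9 tt λ _ → refl
chainT-4-recurrence false false false = ≗-byPrefix 9 tt λ _ → refl

chainT-recurrence : ∀ j → chainT (4 + j) ≗F recurrenceF (chainG (3 + j)) (chainG (2 + j)) (chainG (1 + j))
chainT-recurrence zero    = chainT-4-recurrence
chainT-recurrence (suc j) a b c = begin
  chainT (5 + j) a b c
    ≈⟨ chainPoly-suc 0 2 (λ _ _ → refl) (4 + j) a b c ⟩
  extend (chainT (4 + j)) a b c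
    ≈⟨ L-cong (chainT-recurrence j) ⟩
  extend (recurrenceF (chainG (3 + j)) (chainG (2 + j)) (chainG (1 + j))) a b c
    ≈⟨ linear-recurrence (extend-linear a b c) (chainG (3 + j)) (chainG (2 + j)) (chainG (1 + j)) ⟩
  recurrence (extend (chainG (3 + j)) a b c) (extend (chainG (2 + j)) a b c) (extend (chainG (1 + j)) a b c)
    ≈⟨ recurrence-cong (extend-chainG (3 + j)) (extend-chainG (2 + j)) (extend-chainG (1 + j)) ⟩
  recurrenceF (chainG (4 + j)) (chainG (3 + j)) (chainG (2 + j)) a b c ∎
  where
  open IsLinear (extend-linear a b c)
  extend-chainG : ∀ m → extend (chainG m) a b c ≗ chainG (suc m) a b c
  extend-chainG m = ≗-sym (chainPoly-suc 1 0 (λ _ _ → refl) m a b c)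

mainTheorem5 : (n : ℕ) → 3 ≤ n → (i : ℕ) →
    Dt (T n) i ≡ (Dt (G (n ∸ 1)) ⊕ X· (Dt (G (n ∸ 1))) ⊕ X· (X· (Dt (G (n ∸ 2)) ⊕ Dt (G (n ∸ 3))))) i
mainTheorem5 1 (s≤s ())
mainTheorem5 2 (s≤s (s≤s ()))
mainTheorem5 3 _ = Dt-T3-recurrence
mainTheorem5 4 _ = Dt-T4-recurrence
mainTheorem5 (suc (suc (suc (suc (suc j))))) _ = begin
  Dt (T (5 + j))
    ≈⟨ Dt-T≗close (4 + j) ⟩
  close (chainT (4 + j))
    ≈⟨ IsLinear.L-cong close-linear (chainT-recurrence j) ⟩
  close (recurrenceF (chainG (3 + j)) (chainG (2 + j)) (chainG (1 + j)))
    ≈⟨ linear-recurrence close-linear (chainG (3 + j)) (chainG (2 + j)) (chainG (1 + j)) ⟩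
  recurrence (close (chainG (3 + j))) (close (chainG (2 + j))) (close (chainG (1 + j)))
    ≈⟨ recurrence-cong (≗-sym (Dt-G≗close (3 + j))) (≗-sym (Dt-G≗close (2 + j))) (≗-sym (Dt-G≗close (1 + j))) ⟩
  recurrence (Dt (G (4 + j))) (Dt (G (3 + j))) (Dt (G (2 + j))) ∎
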